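{- Let $q$ be a prime and let $r>2$ be an integer such that there exists an element of multiplicative order exactly $r$ in $(\mathbb{Z}/q\mathbb{Z})^\times$. Let $n_{r,q}$ denote the smallest (in absolute value) minimal residue modulo $q$ which has multiplicative order exactly $r$ modulo $q$. Let $\varphi$ denote Euler's totient function. If $r$ has at most two distinct prime factors, and these are odd, then \[ |n_{r,q}| \ge \left(\frac{q}{\varphi(r)}\right)^{1/\varphi(r)}. \]
   Context: A minimal residue of an integer modulo $q$ is its representative modulo $q$ of smallest absolute value (an integer $x$ with $|x|\le q/2$). The order of a residue modulo $q$ means its multiplicative order in $(\mathbb{Z}/q\mathbb{Z})^\times$. -}

module Defs where

open import Data.Nat as ℕ using (ℕ; zero; suc; _<_)
open import Data.Nat.GCD using (gcd)
open import Data.Nat.Primality using (Prime)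
open import Data.Integer as ℤ using (ℤ; +_; _-_; _^_; ∣_∣)
open import Data.Integer.Divisibility using (_∣_)
open import Data.List using (List; length; filter; map)
open import Data.List.Base using (upTo)
open import Data.Product using (_×_; ∃₂)
open import Data.Sum using (_⊎_)
open import Relation.Nullary using (¬_)
open import Relation.Binary.PropositionalEquality using (_≡_)
import Data.Nat.Properties as ℕP

φ : ℕ → ℕ
φ r = length (filter (λ k → gcd k r ℕP.≟ 1) (map suc (upTo r)))

HasOrder : ℕ → ℤ → ℕ → Set
HasOrder q x r =
  (0 < r) × ((+ q) ∣ (x ^ r - + 1)) ×
  (∀ (k : ℕ) → 0 < k → k < r → ¬ ((+ q) ∣ (x ^ k - + 1)))

IsMinimalResidue : ℕ → ℤ → Set
IsMinimalResidue q x = 2 ℕ.* ∣ x ∣ ℕ.≤ q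

AtMostTwoPrimeFactors : ℕ → Set
AtMostTwoPrimeFactors r =
  ∃₂ λ p₁ p₂ → ∀ (p : ℕ) → Prime p → p Data.Nat.Divisibility.∣ r → (p ≡ p₁) ⊎ (p ≡ p₂)
  where import Data.Nat.Divisibility

OddPrimeFactors : ℕ → Set
OddPrimeFactors r = ∀ (p : ℕ) → Prime p → p Data.Nat.Divisibility.∣ r → ¬ (2 Data.Nat.Divisibility.∣ p)
  where import Data.Nat.Divisibility

module Submission where

-- Write G_k(y) = 1 + y + ⋯ + y ^ (k - 1), so (y - 1) G_k(y) = y ^ k - 1.
--  * r = m p with p the only prime factor: N = n ^ m has order p, so q divides G_p(N) (but not
--    N - 1), whence q ≤ |G_p(N)| ≤ 2 |N| ^ (p - 1) = 2 |n| ^ (m (p - 1)).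
--  * r = m p s with p ≠ s its prime factors: G_p(N) and G_s(N) are coprime (a common divisor divides
--    N - 1, hence p and s), and G_p(N) G_s(N ^ p) = G_(ps)(N) = G_s(N) G_p(N ^ s), so
--    G_p(N ^ s) = a G_p(N).  The prime q divides G_p(N ^ s) but not G_p(N), so q ≤ a ≤ 4 |N| ^ ((p-1)(s-1)).
--  * Inclusion–exclusion gives φ(r) ≥ m (p - 1), resp. m (p - 1)(s - 1), which is ≥ 2 resp. ≥ 4
--    because p, s ≥ 3; so both bounds are at most φ(r) |n| ^ φ(r).

module Primes where

  open import Data.Nat as ℕ using (ℕ; zero; suc; _*_; _≤_; s≤s; z≤n)
  import Data.Nat.Properties as ℕ
  open import Data.Nat.Divisibility using (_∣_; divides; ∣-refl; m∣m*n; *-monoʳ-∣)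
  open import Data.Nat.Primality using (Prime; prime⇒irreducible; prime⇒nonTrivial)
  open import Data.Nat.Primality.Factorisation using (factorise)
  open import Data.Nat.Coprimality as Coprime using (Coprime; coprime-divisor)
  open import Data.Nat.ListAction using (product)
  open import Data.List using ([]; _∷_)
  open import Data.List.Relation.Unary.All using (_∷_)
  open import Data.Product using (∃; _×_; _,_)
  open import Data.Sum using (inj₁; inj₂)
  open import Relation.Nullary using (¬_; contradiction)
  open import Relation.Binary.PropositionalEquality

  prime-factor : ∀ n → 2 ≤ n → ∃ λ p → Prime p × p ∣ n
  prime-factor n 2≤n with factorise n {{ℕ.>-nonZero (ℕ.<-trans (s≤s z≤n) 2≤n)}}
  ... | record { factors = [] ; isFactorisation = n≡1 } = contradiction (sym n≡1) (ℕ.<⇒≢ 2≤n)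
  ... | record { factors = p ∷ ps ; isFactorisation = n≡p*ps ; factorsPrime = pp ∷ _ } =
    p , pp , subst (p ∣_) (sym n≡p*ps) (m∣m*n (product ps))

  distinct-primes-coprime : ∀ {p s} → Prime p → Prime s → p ≢ s → Coprime p s
  distinct-primes-coprime pp ps p≢s (d∣p , d∣s) with prime⇒irreducible pp d∣p
  ... | inj₁ d≡1 = d≡1
  ... | inj₂ refl with prime⇒irreducible ps d∣s
  ...   | inj₁ p≡1 = contradiction p≡1 (ℕ.nonTrivial⇒≢1 {{prime⇒nonTrivial pp}})
  ...   | inj₂ p≡s = contradiction p≡s p≢s

  coprime-product∣ : ∀ {m n k} → Coprime m n → m ∣ k → n ∣ k → m * n ∣ k
  coprime-product∣ {m} {n} m⊥n (divides t refl) n∣tm =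
    subst (m * n ∣_) (ℕ.*-comm m t)
      (*-monoʳ-∣ m (coprime-divisor (Coprime.sym m⊥n) (subst (n ∣_) (ℕ.*-comm t m) n∣tm)))

  odd-prime≥3 : ∀ {p} → Prime p → ¬ 2 ∣ p → 3 ≤ p
  odd-prime≥3 {p} pp = 2≤p∧odd⇒3≤p p (ℕ.nonTrivial⇒n>1 p {{prime⇒nonTrivial pp}})
    where
    2≤p∧odd⇒3≤p : ∀ p → 2 ≤ p → ¬ 2 ∣ p → 3 ≤ p
    2≤p∧odd⇒3≤p zero                ()
    2≤p∧odd⇒3≤p (suc zero)          (s≤s ())
    2≤p∧odd⇒3≤p (suc (suc zero))    _ 2∤2 = contradiction ∣-refl 2∤2
    2≤p∧odd⇒3≤p (suc (suc (suc _))) _ _   = s≤s (s≤s (s≤s z≤n))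

module PrimeFactorShapes where

  open import Data.Nat as ℕ using (ℕ)
  import Data.Nat.Properties as ℕ
  open import Data.Nat.Divisibility using (_∣_; _∣?_)
  open import Data.Nat.Primality using (Prime; prime?)
  open import Data.Product using (_×_; _,_)
  open import Data.Sum using (_⊎_; inj₁; inj₂)
  open import Function using (_∘_)
  open import Relation.Nullary using (¬_; Dec; yes; no; contradiction)
  open import Relation.Nullary.Decidable using (_×-dec_; ¬?)
  open import Relation.Binary.PropositionalEquality
  open import Defs using (AtMostTwoPrimeFactors)

  data PrimeSupport (r p : ℕ) : Set where
    only-p : (∀ ℓ → Prime ℓ → ℓ ∣ r → ℓ ≡ p) → PrimeSupport r p
    p-and  : ∀ s → Prime s → s ∣ r → p ≢ s → (∀ ℓ → Prime ℓ → ℓ ∣ r → ℓ ≡ p ⊎ ℓ ≡ s) → PrimeSupport r p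

  OtherPrimeFactor : ℕ → ℕ → ℕ → Set
  OtherPrimeFactor r p c = Prime c × c ∣ r × c ≢ p

  other-prime-factor? : ∀ r p c → Dec (OtherPrimeFactor r p c)
  other-prime-factor? r p c = prime? c ×-dec c ∣? r ×-dec ¬? (c ℕ.≟ p)

  pigeonhole : ∀ {a b x y z : ℕ} → x ≡ a ⊎ x ≡ b → y ≡ a ⊎ y ≡ b → z ≡ a ⊎ z ≡ b → x ≢ y → x ≢ z → y ≡ z
  pigeonhole (inj₁ refl) (inj₁ refl) _           x≢y _   = contradiction refl x≢y
  pigeonhole (inj₁ refl) (inj₂ refl) (inj₁ refl) _   x≢z = contradiction refl x≢z
  pigeonhole (inj₁ refl) (inj₂ refl) (inj₂ refl) _   _   = refl
  pigeonhole (inj₂ refl) (inj₂ refl) _           x≢y _   = contradiction refl x≢y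
  pigeonhole (inj₂ refl) (inj₁ refl) (inj₁ refl) _   _   = refl
  pigeonhole (inj₂ refl) (inj₁ refl) (inj₂ refl) _   x≢z = contradiction refl x≢z

  two-of-two : ∀ {r p s p₁ p₂} → (∀ ℓ → Prime ℓ → ℓ ∣ r → ℓ ≡ p₁ ⊎ ℓ ≡ p₂) →
    Prime p → p ∣ r → Prime s → s ∣ r → p ≢ s → ∀ ℓ → Prime ℓ → ℓ ∣ r → ℓ ≡ p ⊎ ℓ ≡ s
  two-of-two {p = p} in-p₁p₂ pp p∣r ps s∣r p≢s ℓ pℓ ℓ∣r with ℓ ℕ.≟ p
  ... | yes ℓ≡p = inj₁ ℓ≡p
  ... | no  ℓ≢p = inj₂ (pigeonhole (in-p₁p₂ _ pp p∣r) (in-p₁p₂ ℓ pℓ ℓ∣r) (in-p₁p₂ _ ps s∣r) (ℓ≢p ∘ sym) p≢s)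

  no-other⇒only : ∀ {r p p₁ p₂} → (∀ ℓ → Prime ℓ → ℓ ∣ r → ℓ ≡ p₁ ⊎ ℓ ≡ p₂) →
    ¬ OtherPrimeFactor r p p₁ → ¬ OtherPrimeFactor r p p₂ → ∀ ℓ → Prime ℓ → ℓ ∣ r → ℓ ≡ p
  no-other⇒only {p = p} in-p₁p₂ ¬other₁ ¬other₂ ℓ pℓ ℓ∣r with ℓ ℕ.≟ p
  ... | yes ℓ≡p = ℓ≡p
  ... | no  ℓ≢p with in-p₁p₂ ℓ pℓ ℓ∣r
  ...   | inj₁ refl = contradiction (pℓ , ℓ∣r , ℓ≢p) ¬other₁
  ...   | inj₂ refl = contradiction (pℓ , ℓ∣r , ℓ≢p) ¬other₂

  prime-support : ∀ {r p} → AtMostTwoPrimeFactors r → Prime p → p ∣ r → PrimeSupport r p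
  prime-support {r} {p} (p₁ , p₂ , in-p₁p₂) pp p∣r
    with other-prime-factor? r p p₁ | other-prime-factor? r p p₂
  ... | yes (ps , s∣r , s≢p) | _ =
    p-and p₁ ps s∣r (s≢p ∘ sym) (two-of-two in-p₁p₂ pp p∣r ps s∣r (s≢p ∘ sym))
  ... | no _ | yes (ps , s∣r , s≢p) =
    p-and p₂ ps s∣r (s≢p ∘ sym) (two-of-two in-p₁p₂ pp p∣r ps s∣r (s≢p ∘ sym))
  ... | no ¬other₁ | no ¬other₂ = only-p (no-other⇒only in-p₁p₂ ¬other₁ ¬other₂)

module GeometricSums where

  open import Data.Nat as ℕ using (ℕ; zero; suc; _≤_; _<_; z≤n; s≤s)
  import Data.Nat.Properties as ℕ
  open import Data.Integer as ℤ using (ℤ; +_; 0ℤ; 1ℤ; _+_; _-_; _*_; _^_; ∣_∣)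
  open import Data.Integer.Properties
    using (abs-*; *-zeroʳ; *-distribˡ-+; ^-distribˡ-+-*; ^-*-assoc; ∣i+j∣≤∣i∣+∣j∣; ∣i-j∣≤∣i∣+∣j∣)
  import Data.Integer.Divisibility.Signed as Signed
  open import Data.Integer.Tactic.RingSolver using (solve-∀)
  open import Relation.Binary.PropositionalEquality
  open import Relation.Nullary using (contradiction)

  geomSum : ℕ → ℤ → ℤ
  geomSum zero    y = 0ℤ
  geomSum (suc k) y = geomSum k y + y ^ k

  geomSum-telescope : ∀ k y → (y - 1ℤ) * geomSum k y ≡ y ^ k - 1ℤ
  geomSum-telescope zero    y = *-zeroʳ (y - 1ℤ)
  geomSum-telescope (suc k) y = begin
    (y - 1ℤ) * (geomSum k y + y ^ k)            ≡⟨ *-distribˡ-+ (y - 1ℤ) (geomSum k y) (y ^ k) ⟩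
    (y - 1ℤ) * geomSum k y + (y - 1ℤ) * y ^ k   ≡⟨ cong (_+ (y - 1ℤ) * y ^ k) (geomSum-telescope k y) ⟩
    (y ^ k - 1ℤ) + (y - 1ℤ) * y ^ k             ≡⟨ collect y (y ^ k) ⟩
    y * y ^ k - 1ℤ                              ∎
    where
    open ≡-Reasoning
    collect : ∀ y z → (z - 1ℤ) + (y - 1ℤ) * z ≡ y * z - 1ℤ
    collect = solve-∀

  geomSum-+ : ∀ a b y → geomSum (a ℕ.+ b) y ≡ geomSum a y + y ^ a * geomSum b y
  geomSum-+ a zero y = trans (cong (λ t → geomSum t y) (ℕ.+-identityʳ a)) (vanish (geomSum a y) (y ^ a))
    where
    vanish : ∀ g z → g ≡ g + z * 0ℤ
    vanish = solve-∀
  geomSum-+ a (suc b) y = begin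
    geomSum (a ℕ.+ suc b) y                     ≡⟨ cong (λ t → geomSum t y) (ℕ.+-suc a b) ⟩
    geomSum (a ℕ.+ b) y + y ^ (a ℕ.+ b)         ≡⟨ cong₂ _+_ (geomSum-+ a b y) (^-distribˡ-+-* y a b) ⟩
    (geomSum a y + y ^ a * geomSum b y) + y ^ a * y ^ b
                                                ≡⟨ regroup (geomSum a y) (y ^ a) (geomSum b y) (y ^ b) ⟩
    geomSum a y + y ^ a * (geomSum b y + y ^ b) ∎
    where
    open ≡-Reasoning
    regroup : ∀ g z h w → (g + z * h) + z * w ≡ g + z * (h + w)
    regroup = solve-∀

  geomSum-* : ∀ a b y → geomSum (a ℕ.* b) y ≡ geomSum a y * geomSum b (y ^ a)
  geomSum-* a zero y = trans (cong (λ t → geomSum t y) (ℕ.*-zeroʳ a)) (sym (*-zeroʳ (geomSum a y)))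
  geomSum-* a (suc b) y = begin
    geomSum (a ℕ.* suc b) y                     ≡⟨ cong (λ t → geomSum t y) (a*[1+b]≡a*b+a) ⟩
    geomSum (a ℕ.* b ℕ.+ a) y                   ≡⟨ geomSum-+ (a ℕ.* b) a y ⟩
    geomSum (a ℕ.* b) y + y ^ (a ℕ.* b) * geomSum a y
                                                ≡⟨ cong₂ (λ s t → s + t * geomSum a y) (geomSum-* a b y) (sym (^-*-assoc y a b)) ⟩
    geomSum a y * geomSum b (y ^ a) + (y ^ a) ^ b * geomSum a y
                                                ≡⟨ factor (geomSum a y) (geomSum b (y ^ a)) ((y ^ a) ^ b) ⟩
    geomSum a y * (geomSum b (y ^ a) + (y ^ a) ^ b) ∎
    where
    open ≡-Reasoning
    a*[1+b]≡a*b+a : a ℕ.* suc b ≡ a ℕ.* b ℕ.+ a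
    a*[1+b]≡a*b+a = trans (ℕ.*-suc a b) (ℕ.+-comm a (a ℕ.* b))
    factor : ∀ g h z → g * h + z * g ≡ g * (h + z)
    factor = solve-∀

  pred∣pow-1 : ∀ k y → (y - 1ℤ) Signed.∣ (y ^ k - 1ℤ)
  pred∣pow-1 k y = subst ((y - 1ℤ) Signed.∣_) (geomSum-telescope k y) (Signed.∣m⇒∣m*n (geomSum k y) Signed.∣-refl)

  geomSum-mod-pred : ∀ k y → (y - 1ℤ) Signed.∣ (geomSum k y - + k)
  geomSum-mod-pred zero    y = Signed.divides 0ℤ refl
  geomSum-mod-pred (suc k) y =
    subst ((y - 1ℤ) Signed.∣_) (sym (regroup (geomSum k y) (y ^ k) (+ k)))
      (Signed.∣m∣n⇒∣m+n (geomSum-mod-pred k y) (pred∣pow-1 k y))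
    where
    regroup : ∀ g z k → (g + z) - (1ℤ + k) ≡ (g - k) + (z - 1ℤ)
    regroup = solve-∀

  x+x≡2x : ∀ x → x ℕ.+ x ≡ 2 ℕ.* x
  x+x≡2x x = cong (x ℕ.+_) (sym (ℕ.+-identityʳ x))

  ∣^∣ : ∀ y k → ∣ y ^ k ∣ ≡ ∣ y ∣ ℕ.^ k
  ∣^∣ y zero    = refl
  ∣^∣ y (suc k) = trans (abs-* y (y ^ k)) (cong (∣ y ∣ ℕ.*_) (∣^∣ y k))

  2≤^suc : ∀ {M} k → 2 ≤ M → 2 ≤ M ℕ.^ suc k
  2≤^suc {M} k 2≤M = ℕ.≤-trans 2≤M (ℕ.m≤m*n M (M ℕ.^ k) {{ℕ.m^n≢0 M k {{ℕ.>-nonZero (ℕ.<-trans (s≤s z≤n) 2≤M)}}}})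

  geomSum-step : ∀ k y → ∣ geomSum (suc k) y ∣ ≤ ∣ geomSum k y ∣ ℕ.+ ∣ y ∣ ℕ.^ k
  geomSum-step k y =
    subst (λ t → ∣ geomSum (suc k) y ∣ ≤ ∣ geomSum k y ∣ ℕ.+ t) (∣^∣ y k) (∣i+j∣≤∣i∣+∣j∣ (geomSum k y) (y ^ k))

  geomSum<pow : ∀ k y → 2 ≤ ∣ y ∣ → ∣ geomSum k y ∣ < ∣ y ∣ ℕ.^ k
  geomSum<pow zero    y 2≤M = s≤s z≤n
  geomSum<pow (suc k) y 2≤M = begin-strict
    ∣ geomSum (suc k) y ∣          ≤⟨ geomSum-step k y ⟩
    ∣ geomSum k y ∣ ℕ.+ M ℕ.^ k    <⟨ ℕ.+-monoˡ-< (M ℕ.^ k) (geomSum<pow k y 2≤M) ⟩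
    M ℕ.^ k ℕ.+ M ℕ.^ k            ≡⟨ x+x≡2x (M ℕ.^ k) ⟩
    2 ℕ.* M ℕ.^ k                  ≤⟨ ℕ.*-monoˡ-≤ (M ℕ.^ k) 2≤M ⟩
    M ℕ.^ suc k                    ∎
    where
    open ℕ.≤-Reasoning
    M : ℕ
    M = ∣ y ∣

  geomSum-upper : ∀ k y → 2 ≤ ∣ y ∣ → ∣ geomSum (suc k) y ∣ ≤ 2 ℕ.* ∣ y ∣ ℕ.^ k
  geomSum-upper k y 2≤M = ℕ.≤-trans (geomSum-step k y)
    (ℕ.≤-trans (ℕ.+-monoˡ-≤ _ (ℕ.<⇒≤ (geomSum<pow k y 2≤M))) (ℕ.≤-reflexive (x+x≡2x (∣ y ∣ ℕ.^ k))))

  geomSum-lower : ∀ k y → ∣ y ∣ ℕ.^ k ≤ ∣ geomSum k y ∣ ℕ.* (∣ y ∣ ℕ.+ 1) ℕ.+ 1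
  geomSum-lower k y = begin
    ∣ y ∣ ℕ.^ k                          ≡⟨ ∣^∣ y k ⟨
    ∣ y ^ k ∣                            ≡⟨ cong ∣_∣ (shift (y ^ k)) ⟩
    ∣ (y ^ k - 1ℤ) + 1ℤ ∣                ≤⟨ ∣i+j∣≤∣i∣+∣j∣ (y ^ k - 1ℤ) 1ℤ ⟩
    ∣ y ^ k - 1ℤ ∣ ℕ.+ 1                 ≡⟨ cong (λ t → ∣ t ∣ ℕ.+ 1) (geomSum-telescope k y) ⟨
    ∣ (y - 1ℤ) * g ∣ ℕ.+ 1               ≡⟨ cong (ℕ._+ 1) (trans (abs-* (y - 1ℤ) g) (ℕ.*-comm ∣ y - 1ℤ ∣ ∣ g ∣)) ⟩
    ∣ g ∣ ℕ.* ∣ y - 1ℤ ∣ ℕ.+ 1           ≤⟨ ℕ.+-monoˡ-≤ 1 (ℕ.*-monoʳ-≤ ∣ g ∣ (∣i-j∣≤∣i∣+∣j∣ y 1ℤ)) ⟩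
    ∣ g ∣ ℕ.* (∣ y ∣ ℕ.+ 1) ℕ.+ 1        ∎
    where
    open ℕ.≤-Reasoning
    g : ℤ
    g = geomSum k y
    shift : ∀ z → z ≡ (z - 1ℤ) + 1ℤ
    shift = solve-∀

  geomSum-nonzero : ∀ k y → 2 ≤ ∣ y ∣ → 0 < ∣ geomSum (suc k) y ∣
  geomSum-nonzero k y 2≤M = ℕ.n≢0⇒n>0 λ g≡0 →
    contradiction (subst (λ g → ∣ y ∣ ℕ.^ suc k ≤ g ℕ.* (∣ y ∣ ℕ.+ 1) ℕ.+ 1) g≡0 (geomSum-lower (suc k) y))
                  (ℕ.<⇒≱ (2≤^suc k 2≤M))

module CoprimeGeometricSums where

  open import Data.Nat as ℕ using (suc)
  import Data.Nat.Properties as ℕ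
  import Data.Nat.Divisibility as ℕ
  open import Data.Nat.Coprimality using (Coprime; coprime-Bézout; coprime-divisor)
  open import Data.Nat.GCD using (module Bézout)
  open import Data.Nat.Primality using (Prime)
  open import Data.Integer using (ℤ; +_; 1ℤ; _-_; _*_; _^_; ∣_∣)
  open import Data.Integer.Properties using (abs-*; ^-*-assoc)
  import Data.Integer.Divisibility.Signed as Signed
  open Signed using (_∣_)
  open import Data.Integer.Tactic.RingSolver using (solve-∀)
  open import Data.Product using (_,_)
  open import Relation.Binary.PropositionalEquality
  open GeometricSums
  open Primes using (distinct-primes-coprime)

  ∣pow-1⇒∣pow-mult-1 : ∀ {E} y a x → E ∣ (y ^ a - 1ℤ) → E ∣ (y ^ (x ℕ.* a) - 1ℤ)
  ∣pow-1⇒∣pow-mult-1 {E} y a x E∣ = subst (λ t → E ∣ (y ^ t - 1ℤ)) (ℕ.*-comm a x)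
    (subst (λ t → E ∣ (t - 1ℤ)) (^-*-assoc y a x)
      (subst (E ∣_) (geomSum-telescope x (y ^ a)) (Signed.∣m⇒∣m*n (geomSum x (y ^ a)) E∣)))

  peel-power : ∀ {E} y c → E ∣ (y ^ suc c - 1ℤ) → E ∣ (y ^ c - 1ℤ) → E ∣ (y - 1ℤ)
  peel-power {E} y c E∣y^[1+c]-1 E∣y^c-1 =
    subst (E ∣_) (difference y (y ^ c)) (Signed.∣m∣n⇒∣m-n E∣y^[1+c]-1 (Signed.∣n⇒∣m*n y E∣y^c-1))
    where
    difference : ∀ y z → (y * z - 1ℤ) - y * (z - 1ℤ) ≡ y - 1ℤ
    difference = solve-∀

  -- Bézout in the exponent: for coprime a, b, a common divisor of y ^ a - 1 and y ^ b - 1 divides y - 1.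
  coprime-exponents : ∀ {E} y {a b} → Coprime a b → E ∣ (y ^ a - 1ℤ) → E ∣ (y ^ b - 1ℤ) → E ∣ (y - 1ℤ)
  coprime-exponents {E} y {a} {b} a⊥b E∣a E∣b with coprime-Bézout a⊥b
  ... | Bézout.+- u v 1+vb≡ua = peel-power y (v ℕ.* b)
          (subst (λ t → E ∣ (y ^ t - 1ℤ)) (sym 1+vb≡ua) (∣pow-1⇒∣pow-mult-1 y a u E∣a))
          (∣pow-1⇒∣pow-mult-1 y b v E∣b)
  ... | Bézout.-+ u v 1+ua≡vb = peel-power y (u ℕ.* a)
          (subst (λ t → E ∣ (y ^ t - 1ℤ)) (sym 1+ua≡vb) (∣pow-1⇒∣pow-mult-1 y b v E∣b))
          (∣pow-1⇒∣pow-mult-1 y a u E∣a)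

  -- For distinct primes p, s the sums 1 + ⋯ + y ^ (p - 1) and 1 + ⋯ + y ^ (s - 1) are coprime:
  -- a common divisor divides y ^ p - 1 and y ^ s - 1, hence y - 1, hence (reducing modulo y - 1) p and s.
  geomSum-coprime : ∀ {p s} y → Prime p → Prime s → p ≢ s → Coprime ∣ geomSum p y ∣ ∣ geomSum s y ∣
  geomSum-coprime {p} {s} y pp ps p≢s {e} (e∣Gp , e∣Gs) =
    distinct-primes-coprime pp ps p≢s (Signed.∣⇒∣ᵤ (E∣exponent p E∣Gp) , Signed.∣⇒∣ᵤ (E∣exponent s E∣Gs))
    where
    E : ℤ
    E = + e
    E∣Gp : E ∣ geomSum p y
    E∣Gp = Signed.∣ᵤ⇒∣ e∣Gp
    E∣Gs : E ∣ geomSum s y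
    E∣Gs = Signed.∣ᵤ⇒∣ e∣Gs
    E∣pow-1 : ∀ k → E ∣ geomSum k y → E ∣ (y ^ k - 1ℤ)
    E∣pow-1 k E∣G = subst (E ∣_) (geomSum-telescope k y) (Signed.∣n⇒∣m*n (y - 1ℤ) E∣G)
    E∣y-1 : E ∣ (y - 1ℤ)
    E∣y-1 = coprime-exponents y (distinct-primes-coprime pp ps p≢s) (E∣pow-1 p E∣Gp) (E∣pow-1 s E∣Gs)
    E∣exponent : ∀ k → E ∣ geomSum k y → E ∣ + k
    E∣exponent k E∣G = subst (E ∣_) (difference (geomSum k y) (+ k))
      (Signed.∣m∣n⇒∣m-n E∣G (Signed.∣-trans E∣y-1 (geomSum-mod-pred k y)))
      where
      difference : ∀ g k → g - (g - k) ≡ k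
      difference = solve-∀

  -- Hence 1 + ⋯ + y ^ (p - 1) divides 1 + y ^ s + ⋯ + y ^ (s (p - 1)): both sides of
  -- geomSum p y · geomSum s (y ^ p) = geomSum (p s) y = geomSum s y · geomSum p (y ^ s)
  -- are divisible by it, and it is coprime to geomSum s y.
  geomSum-divides : ∀ {p s} y → Prime p → Prime s → p ≢ s → ∣ geomSum p y ∣ ℕ.∣ ∣ geomSum p (y ^ s) ∣
  geomSum-divides {p} {s} y pp ps p≢s =
    coprime-divisor (geomSum-coprime y pp ps p≢s) (subst (∣ geomSum p y ∣ ℕ.∣_) swap (ℕ.m∣m*n _))
    where
    both-ways : geomSum p y * geomSum s (y ^ p) ≡ geomSum s y * geomSum p (y ^ s)
    both-ways = trans (sym (geomSum-* p s y)) (trans (cong (λ t → geomSum t y) (ℕ.*-comm p s)) (geomSum-* s p y))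
    swap : ∣ geomSum p y ∣ ℕ.* ∣ geomSum s (y ^ p) ∣ ≡ ∣ geomSum s y ∣ ℕ.* ∣ geomSum p (y ^ s) ∣
    swap = trans (sym (abs-* (geomSum p y) _)) (trans (cong ∣_∣ both-ways) (abs-* (geomSum s y) _))

module PrimeDivisorBounds where

  open import Data.Nat as ℕ using (ℕ; suc; _≤_; _<_; _+_; _*_; _^_; z≤n; s≤s)
  import Data.Nat.Properties as ℕ
  open import Data.Nat.Divisibility using (_∣_; ∣⇒≤; ∣n⇒∣m*n)
  open import Data.Nat.Primality using (Prime; euclidsLemma)
  open import Data.Nat.Tactic.RingSolver using (solve-∀)
  open import Data.Integer as ℤ using (1ℤ; _-_; ∣_∣)
  open import Data.Integer.Properties using (abs-*)
  open import Data.Sum using (inj₁; inj₂; [_,_]′)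
  open import Function using (id)
  open import Relation.Nullary using (¬_; contradiction)
  open import Relation.Binary.PropositionalEquality
  open GeometricSums
  open CoprimeGeometricSums using (geomSum-divides)

  ∣pow-1∣ : ∀ k y → ∣ y ℤ.^ k - 1ℤ ∣ ≡ ∣ y - 1ℤ ∣ * ∣ geomSum k y ∣
  ∣pow-1∣ k y = trans (cong ∣_∣ (sym (geomSum-telescope k y))) (abs-* (y - 1ℤ) (geomSum k y))

  prime∣geomSum : ∀ {q} k y → Prime q → q ∣ ∣ y ℤ.^ k - 1ℤ ∣ → ¬ q ∣ ∣ y - 1ℤ ∣ → q ∣ ∣ geomSum k y ∣
  prime∣geomSum k y pq q∣pow-1 q∤y-1 with euclidsLemma ∣ y - 1ℤ ∣ ∣ geomSum k y ∣ pq (subst (_ ∣_) (∣pow-1∣ k y) q∣pow-1)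
  ... | inj₁ q∣y-1 = contradiction q∣y-1 q∤y-1
  ... | inj₂ q∣G   = q∣G

  one-prime-bound : ∀ {q} p' y → Prime q → 2 ≤ ∣ y ∣ →
    q ∣ ∣ y ℤ.^ suc p' - 1ℤ ∣ → ¬ q ∣ ∣ y - 1ℤ ∣ → q ≤ 2 * ∣ y ∣ ^ p'
  one-prime-bound p' y pq 2≤∣y∣ q∣y^p-1 q∤y-1 = ℕ.≤-trans
    (∣⇒≤ {{ℕ.>-nonZero (geomSum-nonzero p' y 2≤∣y∣)}} (prime∣geomSum (suc p') y pq q∣y^p-1 q∤y-1))
    (geomSum-upper p' y 2≤∣y∣)

  -- The size estimate for the cofactor a in  geomSum p (y ^ s) = a · geomSum p y,  with M = |y|,
  -- p = p' + 1, s = s' + 1: the bounds on u = |geomSum p y| and a u give a ≤ 4 M ^ (p' s').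
  cofactor-bound : ∀ {a u M} p' s' → 2 ≤ M → 1 ≤ u → M ^ suc p' ≤ u * (M + 1) + 1 →
    a * u ≤ 2 * (M ^ suc s') ^ p' → a ≤ 4 * M ^ (p' * s')
  cofactor-bound {a} {u} {M} p' s' 2≤M 1≤u M^p≤ au≤ =
    ℕ.*-cancelʳ-≤ a (4 * M ^ (p' * s')) (M ^ suc p') {{ℕ.m^n≢0 M (suc p') {{ℕ.>-nonZero (ℕ.<-trans (s≤s z≤n) 2≤M)}}}} (begin
      a * M ^ suc p'                      ≤⟨ ℕ.*-monoʳ-≤ a M^p≤ ⟩
      a * (u * (M + 1) + 1)               ≤⟨ ℕ.*-monoʳ-≤ a (ℕ.+-monoʳ-≤ (u * (M + 1)) 1≤u) ⟩
      a * (u * (M + 1) + u)               ≡⟨ regroup a u M ⟩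
      (a * u) * (M + 2)                   ≤⟨ ℕ.*-mono-≤ au≤ M+2≤2M ⟩
      2 * (M ^ suc s') ^ p' * (2 * M)     ≡⟨ regroup′ ((M ^ suc s') ^ p') M ⟩
      4 * ((M ^ suc s') ^ p' * M)         ≡⟨ cong (4 *_) exponents ⟩
      4 * (M ^ (p' * s') * M ^ suc p')    ≡⟨ ℕ.*-assoc 4 (M ^ (p' * s')) (M ^ suc p') ⟨
      4 * M ^ (p' * s') * M ^ suc p'      ∎)
    where
    open ℕ.≤-Reasoning
    regroup : ∀ a u M → a * (u * (M + 1) + u) ≡ (a * u) * (M + 2)
    regroup = solve-∀
    regroup′ : ∀ x M → 2 * x * (2 * M) ≡ 4 * (x * M)
    regroup′ = solve-∀
    M+2≤2M : M + 2 ≤ 2 * M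
    M+2≤2M = ℕ.≤-trans (ℕ.+-monoʳ-≤ M 2≤M) (ℕ.≤-reflexive (x+x≡2x M))
    exponent-sum : ∀ p' s' → suc s' * p' + 1 ≡ p' * s' + suc p'
    exponent-sum = solve-∀
    exponents : (M ^ suc s') ^ p' * M ≡ M ^ (p' * s') * M ^ suc p'
    exponents = begin-equality
      (M ^ suc s') ^ p' * M           ≡⟨ cong₂ _*_ (ℕ.^-*-assoc M (suc s') p') (sym (ℕ.*-identityʳ M)) ⟩
      M ^ (suc s' * p') * M ^ 1       ≡⟨ ℕ.^-distribˡ-+-* M (suc s' * p') 1 ⟨
      M ^ (suc s' * p' + 1)           ≡⟨ cong (M ^_) (exponent-sum p' s') ⟩
      M ^ (p' * s' + suc p')          ≡⟨ ℕ.^-distribˡ-+-* M (p' * s') (suc p') ⟩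
      M ^ (p' * s') * M ^ suc p'      ∎

  -- Indeed q divides Y = geomSum p (y ^ s) = a u with
  -- u = geomSum p y, but not u (a divisor of y ^ p - 1); so q divides the cofactor a, and q ≤ a.
  two-prime-bound : ∀ {q} p' s' y → Prime q → Prime (suc p') → Prime (suc s') → suc p' ≢ suc s' →
    2 ≤ ∣ y ∣ → q ∣ ∣ (y ℤ.^ suc s') ℤ.^ suc p' - 1ℤ ∣ →
    ¬ q ∣ ∣ y ℤ.^ suc s' - 1ℤ ∣ → ¬ q ∣ ∣ y ℤ.^ suc p' - 1ℤ ∣ → q ≤ 4 * ∣ y ∣ ^ (p' * s')
  two-prime-bound {q} p' s' y pq pp ps p≢s 2≤∣y∣ q∣y^sp-1 q∤y^s-1 q∤y^p-1 = ℕ.≤-trans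
    (∣⇒≤ {{ℕ.>-nonZero 0<a}} q∣a)
    (cofactor-bound {a} {u} {∣ y ∣} p' s' 2≤∣y∣ (geomSum-nonzero p' y 2≤∣y∣) (geomSum-lower (suc p') y) au≤)
    where
    u : ℕ
    u = ∣ geomSum (suc p') y ∣
    Y : ℕ
    Y = ∣ geomSum (suc p') (y ℤ.^ suc s') ∣
    u∣Y : u ∣ Y
    u∣Y = geomSum-divides y pp ps p≢s
    a : ℕ
    a = _∣_.quotient u∣Y
    Y≡au : Y ≡ a * u
    Y≡au = _∣_.equality u∣Y
    2≤∣y^s∣ : 2 ≤ ∣ y ℤ.^ suc s' ∣
    2≤∣y^s∣ = subst (2 ≤_) (sym (∣^∣ y (suc s'))) (2≤^suc s' 2≤∣y∣)
    q∤u : ¬ q ∣ u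
    q∤u q∣u = q∤y^p-1 (subst (q ∣_) (sym (∣pow-1∣ (suc p') y)) (∣n⇒∣m*n ∣ y - 1ℤ ∣ q∣u))
    q∣a : q ∣ a
    q∣a = [ id , (λ q∣u → contradiction q∣u q∤u) ]′
      (euclidsLemma a u pq (subst (q ∣_) Y≡au (prime∣geomSum (suc p') (y ℤ.^ suc s') pq q∣y^sp-1 q∤y^s-1)))
    0<a : 0 < a
    0<a = ℕ.n≢0⇒n>0 λ a≡0 → ℕ.<⇒≢ (geomSum-nonzero p' (y ℤ.^ suc s') 2≤∣y^s∣) (sym (trans Y≡au (cong (_* u) a≡0)))
    au≤ : a * u ≤ 2 * (∣ y ∣ ^ suc s') ^ p'
    au≤ = subst₂ (λ l r → l ≤ 2 * r ^ p') Y≡au (∣^∣ y (suc s')) (geomSum-upper p' (y ℤ.^ suc s') 2≤∣y^s∣)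

module Counting where

  open import Data.Nat as ℕ using (ℕ; zero; suc; _+_; _*_; _≤_; _<_; z≤n; s≤s)
  import Data.Nat.Properties as ℕ
  open import Data.Nat.Divisibility using (_∣_; _∣?_; n∣m*n; ∣m+n∣m⇒∣n; ∣⇒≤)
  open import Data.Nat.Tactic.RingSolver using (solve-∀)
  open import Data.Bool using (Bool; true; false; not; _∧_)
  open import Data.List using (length; filter; map; _++_; [_])
  open import Data.List.Base using (upTo)
  open import Data.List.Properties using (upTo-∷ʳ; map-++; length-++; filter-++)
  open import Level using (0ℓ)
  open import Relation.Nullary using (¬_; Dec; yes; no; does; contradiction)
  open import Relation.Nullary.Decidable using (dec-true; dec-false)
  open import Relation.Unary using (Pred; Decidable)
  open import Relation.Binary.PropositionalEquality hiding ([_])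

  indicator : Bool → ℕ
  indicator true  = 1
  indicator false = 0

  count : (ℕ → Bool) → ℕ → ℕ
  count f zero    = 0
  count f (suc n) = count f n + indicator (f (suc n))

  length-filter≡count : ∀ {P : Pred ℕ 0ℓ} (P? : Decidable P) n →
    length (filter P? (map suc (upTo n))) ≡ count (λ k → does (P? k)) n
  length-filter≡count P? zero    = refl
  length-filter≡count P? (suc n) = begin
    length (filter P? (map suc (upTo (suc n))))
      ≡⟨ cong (λ l → length (filter P? (map suc l))) (sym (upTo-∷ʳ n)) ⟩
    length (filter P? (map suc (upTo n ++ [ n ])))
      ≡⟨ cong (λ l → length (filter P? l)) (map-++ suc (upTo n) [ n ]) ⟩
    length (filter P? (map suc (upTo n) ++ [ suc n ]))
      ≡⟨ cong length (filter-++ P? (map suc (upTo n)) [ suc n ]) ⟩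
    length (filter P? (map suc (upTo n)) ++ filter P? [ suc n ])
      ≡⟨ length-++ (filter P? (map suc (upTo n))) ⟩
    length (filter P? (map suc (upTo n))) + length (filter P? [ suc n ])
      ≡⟨ cong₂ _+_ (length-filter≡count P? n) (length-filter-singleton (suc n)) ⟩
    count (λ k → does (P? k)) (suc n) ∎
    where
    open ≡-Reasoning
    length-filter-singleton : ∀ x → length (filter P? [ x ]) ≡ indicator (does (P? x))
    length-filter-singleton x with P? x
    ... | yes _ = refl
    ... | no  _ = refl

  count-cong : ∀ {f g} → (∀ k → f k ≡ g k) → ∀ n → count f n ≡ count g n
  count-cong f≗g zero    = refl
  count-cong f≗g (suc n) = cong₂ _+_ (count-cong f≗g n) (cong indicator (f≗g (suc n)))

  indicator-mono : ∀ {A B : Set} (a? : Dec A) (b? : Dec B) → (A → B) → indicator (does a?) ≤ indicator (does b?)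
  indicator-mono (no _)  _       _   = z≤n
  indicator-mono (yes _) (yes _) _   = ℕ.≤-refl
  indicator-mono (yes a) (no ¬b) A⇒B = contradiction (A⇒B a) ¬b

  count-mono : ∀ {A B : ℕ → Set} (A? : ∀ k → Dec (A k)) (B? : ∀ k → Dec (B k)) → (∀ k → A k → B k) →
    ∀ n → count (λ k → does (A? k)) n ≤ count (λ k → does (B? k)) n
  count-mono A? B? A⇒B zero    = z≤n
  count-mono A? B? A⇒B (suc n) =
    ℕ.+-mono-≤ (count-mono A? B? A⇒B n) (indicator-mono (A? (suc n)) (B? (suc n)) (A⇒B (suc n)))

  count-complement : ∀ f n → count (λ k → not (f k)) n + count f n ≡ n
  count-complement f zero    = refl
  count-complement f (suc n) = begin
    (A + a) + (F + b)   ≡⟨ shuffle A a F b ⟩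
    (A + F) + (a + b)   ≡⟨ cong₂ _+_ (count-complement f n) (split (f (suc n))) ⟩
    n + 1               ≡⟨ ℕ.+-comm n 1 ⟩
    suc n               ∎
    where
    open ≡-Reasoning
    A a F b : ℕ
    A = count (λ k → not (f k)) n
    a = indicator (not (f (suc n)))
    F = count f n
    b = indicator (f (suc n))
    shuffle : ∀ A a F b → (A + a) + (F + b) ≡ (A + F) + (a + b)
    shuffle = solve-∀
    split : ∀ x → indicator (not x) + indicator x ≡ 1
    split true  = refl
    split false = refl

  count-inclusion-exclusion : ∀ f g n →
    count (λ k → not (f k) ∧ not (g k)) n + count f n + count g n ≡ n + count (λ k → f k ∧ g k) n
  count-inclusion-exclusion f g zero    = refl
  count-inclusion-exclusion f g (suc n) = begin
    (A + a) + (F + b) + (G + c)     ≡⟨ shuffle A a F b G c ⟩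
    (A + F + G) + (a + b + c)       ≡⟨ cong₂ _+_ (count-inclusion-exclusion f g n) (split (f (suc n)) (g (suc n))) ⟩
    (n + B) + (1 + d)               ≡⟨ shuffle′ n B d ⟩
    suc n + (B + d)                 ∎
    where
    open ≡-Reasoning
    A a F b G c B d : ℕ
    A = count (λ k → not (f k) ∧ not (g k)) n
    a = indicator (not (f (suc n)) ∧ not (g (suc n)))
    F = count f n
    b = indicator (f (suc n))
    G = count g n
    c = indicator (g (suc n))
    B = count (λ k → f k ∧ g k) n
    d = indicator (f (suc n) ∧ g (suc n))
    shuffle : ∀ A a F b G c → (A + a) + (F + b) + (G + c) ≡ (A + F + G) + (a + b + c)
    shuffle = solve-∀
    shuffle′ : ∀ n B d → (n + B) + (1 + d) ≡ suc n + (B + d)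
    shuffle′ = solve-∀
    split : ∀ x y → indicator (not x ∧ not y) + indicator x + indicator y ≡ 1 + indicator (x ∧ y)
    split true  true  = refl
    split true  false = refl
    split false true  = refl
    split false false = refl

  divisible-by : ℕ → ℕ → Bool
  divisible-by d k = does (d ∣? k)

  count-multiples-offset : ∀ d' c j → j < suc d' → count (divisible-by (suc d')) (c * suc d' + j) ≡ c
  count-multiples-offset d' zero    zero    _ = refl
  count-multiples-offset d' (suc c) zero    _ = begin
    count (divisible-by d) (suc c * d + 0)               ≡⟨ cong (count (divisible-by d)) last-multiple ⟩
    count (divisible-by d) (c * d + d') + indicator (divisible-by d (suc (c * d + d')))
                                                         ≡⟨ cong₂ _+_ (count-multiples-offset d' c d' ℕ.≤-refl)
                                                                      (cong indicator (dec-true (d ∣? _) d∣)) ⟩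
    c + 1                                                ≡⟨ ℕ.+-comm c 1 ⟩
    suc c                                                ∎
    where
    open ≡-Reasoning
    d : ℕ
    d = suc d'
    last-multiple : suc c * d + 0 ≡ suc (c * d + d')
    last-multiple = trans (ℕ.+-identityʳ _) (trans (ℕ.+-comm d (c * d)) (ℕ.+-suc (c * d) d'))
    d∣ : d ∣ suc (c * d + d')
    d∣ = subst (d ∣_) (trans (sym (ℕ.+-identityʳ _)) last-multiple) (n∣m*n (suc c))
  count-multiples-offset d' c (suc j) (s≤s j<d') = begin
    count (divisible-by d) (c * d + suc j)               ≡⟨ cong (count (divisible-by d)) (ℕ.+-suc (c * d) j) ⟩
    count (divisible-by d) (c * d + j) + indicator (divisible-by d (suc (c * d + j)))
                                                         ≡⟨ cong₂ _+_ (count-multiples-offset d' c j (ℕ.m≤n⇒m≤1+n j<d'))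
                                                                      (cong indicator (dec-false (d ∣? _) d∤)) ⟩
    c + 0                                                ≡⟨ ℕ.+-identityʳ c ⟩
    c                                                    ∎
    where
    open ≡-Reasoning
    d : ℕ
    d = suc d'
    d∤ : ¬ d ∣ suc (c * d + j)
    d∤ d∣ = ℕ.<⇒≱ (s≤s j<d') (∣⇒≤ (∣m+n∣m⇒∣n (subst (d ∣_) (sym (ℕ.+-suc (c * d) j)) d∣) (n∣m*n c)))

  count-multiples : ∀ d' c → count (divisible-by (suc d')) (c * suc d') ≡ c
  count-multiples d' c =
    trans (cong (count (divisible-by (suc d'))) (sym (ℕ.+-identityʳ (c * suc d')))) (count-multiples-offset d' c 0 (s≤s z≤n))

module TotientBounds where

  open import Data.Nat as ℕ using (ℕ; zero; suc; _+_; _*_; _≤_; z≤n; s≤s)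
  import Data.Nat.Properties as ℕ
  open import Data.Nat.Divisibility using (_∣_; _∣?_; ∣-trans; m*n∣⇒m∣; m*n∣⇒n∣)
  open import Data.Nat.GCD using (gcd; gcd[m,n]∣m; gcd[m,n]∣n; gcd[m,n]≢0)
  open import Data.Nat.Primality using (Prime)
  open import Data.Nat.Tactic.RingSolver using (solve-∀)
  open import Data.Bool using (not; _∧_)
  open import Data.Product using (_×_; _,_)
  open import Data.Sum using (_⊎_; inj₂; [_,_])
  open import Function.Bundles using (mk⇔)
  open import Relation.Nullary using (¬_; Dec; does; contradiction)
  open import Relation.Nullary.Decidable using (¬?; _×-dec_; does-⇔)
  open import Relation.Binary.PropositionalEquality hiding ([_])
  open import Defs using (φ)
  open Counting
  open Primes using (prime-factor; distinct-primes-coprime; coprime-product∣)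

  φ≡count : ∀ r → φ r ≡ count (λ k → does (gcd k r ℕ.≟ 1)) r
  φ≡count r = length-filter≡count (λ k → gcd k r ℕ.≟ 1) r

  -- k is coprime to r ≠ 0 as soon as no prime factor of r divides k:
  -- otherwise a prime factor of gcd k r > 1 would divide both.
  no-common-prime⇒gcd≡1 : ∀ {k r} → r ≢ 0 → (∀ ℓ → Prime ℓ → ℓ ∣ r → ¬ ℓ ∣ k) → gcd k r ≡ 1
  no-common-prime⇒gcd≡1 {k} {r} r≢0 avoid
    with gcd k r | gcd[m,n]∣m k r | gcd[m,n]∣n k r | gcd[m,n]≢0 k r (inj₂ r≢0)
  ... | zero        | _   | _   | g≢0 = contradiction refl g≢0
  ... | suc zero    | _   | _   | _   = refl
  ... | suc (suc g) | g∣k | g∣r | _ with prime-factor (suc (suc g)) (s≤s (s≤s z≤n))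
  ...   | ℓ , pℓ , ℓ∣g = contradiction (∣-trans ℓ∣g g∣k) (avoid ℓ pℓ (∣-trans ℓ∣g g∣r))

  count≤φ : ∀ {r} {A : ℕ → Set} (A? : ∀ k → Dec (A k)) → r ≢ 0 →
    (∀ k → A k → ∀ ℓ → Prime ℓ → ℓ ∣ r → ¬ ℓ ∣ k) → count (λ k → does (A? k)) r ≤ φ r
  count≤φ {r} A? r≢0 avoid = ℕ.≤-trans
    (count-mono A? (λ k → gcd k r ℕ.≟ 1) (λ k a → no-common-prime⇒gcd≡1 r≢0 (avoid k a)) r)
    (ℕ.≤-reflexive (sym (φ≡count r)))

  -- If p is the only prime factor of r = m p, then φ r ≥ m (p - 1): the non-multiples of p are coprime to r.
  φ-one-prime : ∀ {r} m p' → r ≢ 0 → r ≡ m * suc p' →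
    (∀ ℓ → Prime ℓ → ℓ ∣ r → ℓ ≡ suc p') → m * p' ≤ φ r
  φ-one-prime {r} m p' r≢0 r≡mp only-p = begin
    m * p'     ≡⟨ count-non-multiples ⟨
    A          ≤⟨ count≤φ (λ k → ¬? (p ∣? k)) r≢0 avoids ⟩
    φ r                                       ∎
    where
    open ℕ.≤-Reasoning
    p A : ℕ
    p = suc p'
    A = count (λ k → not (divisible-by p k)) r
    avoids : ∀ k → ¬ p ∣ k → ∀ ℓ → Prime ℓ → ℓ ∣ r → ¬ ℓ ∣ k
    avoids k p∤k ℓ pℓ ℓ∣r ℓ∣k = p∤k (subst (_∣ k) (only-p ℓ pℓ ℓ∣r) ℓ∣k)
    count-multiples-p : count (divisible-by p) r ≡ m
    count-multiples-p = trans (cong (count (divisible-by p)) r≡mp) (count-multiples p' m)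
    count-non-multiples : A ≡ m * p'
    count-non-multiples = ℕ.+-cancelʳ-≡ m A (m * p') (begin-equality
      A + m                              ≡⟨ cong (A +_) count-multiples-p ⟨
      A + count (divisible-by p) r       ≡⟨ count-complement (divisible-by p) r ⟩
      r                                  ≡⟨ r≡mp ⟩
      m * suc p'                         ≡⟨ ℕ.*-suc m p' ⟩
      m + m * p'                         ≡⟨ ℕ.+-comm m (m * p') ⟩
      m * p' + m                         ∎)

  -- If p ≠ s are the only prime factors of r = m p s, then φ r ≥ m (p - 1)(s - 1),
  -- by inclusion–exclusion on the multiples of p and of s.
  φ-two-primes : ∀ {r} m p' s' → r ≢ 0 → Prime (suc p') → Prime (suc s') → suc p' ≢ suc s' →
    r ≡ m * (suc p' * suc s') → (∀ ℓ → Prime ℓ → ℓ ∣ r → ℓ ≡ suc p' ⊎ ℓ ≡ suc s') → m * (p' * s') ≤ φ r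
  φ-two-primes {r} m p' s' r≢0 pp ps p≢s r≡mps only-p-s = begin
    m * (p' * s')  ≡⟨ ℕ.+-cancelʳ-≡ (m * s + m * p) A (m * (p' * s')) inclusion-exclusion ⟨
    A              ≤⟨ count≤φ (λ k → ¬? (p ∣? k) ×-dec ¬? (s ∣? k)) r≢0 avoids ⟩
    φ r            ∎
    where
    open ℕ.≤-Reasoning
    p s A : ℕ
    p = suc p'
    s = suc s'
    A = count (λ k → not (divisible-by p k) ∧ not (divisible-by s k)) r
    avoids : ∀ k → (¬ p ∣ k) × (¬ s ∣ k) → ∀ ℓ → Prime ℓ → ℓ ∣ r → ¬ ℓ ∣ k
    avoids k (p∤k , s∤k) ℓ pℓ ℓ∣r ℓ∣k =
      [ (λ ℓ≡p → p∤k (subst (_∣ k) ℓ≡p ℓ∣k)) , (λ ℓ≡s → s∤k (subst (_∣ k) ℓ≡s ℓ∣k)) ] (only-p-s ℓ pℓ ℓ∣r)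
    multiples-p : count (divisible-by p) r ≡ m * s
    multiples-p = trans (cong (count (divisible-by p)) (trans r≡mps (regroup m p s))) (count-multiples p' (m * s))
      where
      regroup : ∀ m p s → m * (p * s) ≡ m * s * p
      regroup = solve-∀
    multiples-s : count (divisible-by s) r ≡ m * p
    multiples-s = trans (cong (count (divisible-by s)) (trans r≡mps (sym (ℕ.*-assoc m p s)))) (count-multiples s' (m * p))
    -- multiples of both p and s are the multiples of p s
    multiples-ps : count (λ k → divisible-by p k ∧ divisible-by s k) r ≡ m
    multiples-ps = trans
      (count-cong (λ k → does-⇔ (mk⇔ (λ (p∣k , s∣k) → coprime-product∣ (distinct-primes-coprime pp ps p≢s) p∣k s∣k)
                                       (λ ps∣k → m*n∣⇒m∣ p s ps∣k , m*n∣⇒n∣ p s ps∣k))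
                                 (p ∣? k ×-dec s ∣? k) (p * s ∣? k)) r)
      (trans (cong (count (divisible-by (p * s))) r≡mps) (count-multiples (s' + p' * s) m))
    inclusion-exclusion : A + (m * s + m * p) ≡ m * (p' * s') + (m * s + m * p)
    inclusion-exclusion = begin-equality
      A + (m * s + m * p)                            ≡⟨ ℕ.+-assoc A (m * s) (m * p) ⟨
      A + m * s + m * p                              ≡⟨ cong₂ (λ x y → A + x + y) multiples-p multiples-s ⟨
      A + count (divisible-by p) r + count (divisible-by s) r
                                                     ≡⟨ count-inclusion-exclusion (divisible-by p) (divisible-by s) r ⟩
      r + count (λ k → divisible-by p k ∧ divisible-by s k) r
                                                     ≡⟨ cong₂ _+_ r≡mps multiples-ps ⟩
      m * (p * s) + m                                ≡⟨ expand m p' s' ⟩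
      m * (p' * s') + (m * s + m * p)                ∎
      where
      expand : ∀ m p' s' → m * (suc p' * suc s') + m ≡ m * (p' * s') + (m * suc s' + m * suc p')
      expand = solve-∀

module OrderCases where

  open import Data.Nat as ℕ using (ℕ; zero; suc; _*_; _^_; _≤_; _<_; z≤n; s≤s)
  import Data.Nat.Properties as ℕ
  open import Data.Nat.Divisibility using (_∣_; divides; ∣1⇒≡1)
  open import Data.Nat.Primality using (Prime; prime⇒nonTrivial)
  open import Data.Integer as ℤ using (+_; -[1+_]; 1ℤ; _-_; ∣_∣)
  open import Data.Integer.Properties using (^-*-assoc)
  open import Data.Product using (_,_)
  open import Data.Sum using (_⊎_)
  open import Relation.Nullary using (¬_; contradiction)
  open import Relation.Binary.PropositionalEquality
  open import Defs using (φ; HasOrder)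
  open GeometricSums using (∣^∣; 2≤^suc)
  open Primes using (distinct-primes-coprime; coprime-product∣)
  open PrimeDivisorBounds using (one-prime-bound; two-prime-bound)
  open TotientBounds using (φ-one-prime; φ-two-primes)

  order>2⇒2≤∣n∣ : ∀ {q r n} → Prime q → 2 < r → HasOrder q n r → 2 ≤ ∣ n ∣
  order>2⇒2≤∣n∣ {r = zero}  {n = + 0}           pq ()  _
  order>2⇒2≤∣n∣ {r = suc _} {n = + 0}           pq 2<r (_ , q∣-1 , _)   =
    contradiction (∣1⇒≡1 q∣-1) (ℕ.nonTrivial⇒≢1 {{prime⇒nonTrivial pq}})
  order>2⇒2≤∣n∣             {n = + 1}           pq 2<r (_ , _ , minimal) =
    contradiction (divides 0 refl) (minimal 1 (s≤s z≤n) (ℕ.<-trans (s≤s (s≤s z≤n)) 2<r))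
  order>2⇒2≤∣n∣             {n = + suc (suc _)} pq 2<r _                 = s≤s (s≤s z≤n)
  order>2⇒2≤∣n∣             {n = -[1+ 0 ]}      pq 2<r (_ , _ , minimal) =
    contradiction (divides 0 refl) (minimal 2 (s≤s z≤n) 2<r)
  order>2⇒2≤∣n∣             {n = -[1+ suc _ ]}  pq 2<r _                 = s≤s (s≤s z≤n)

  power-order : ∀ {q r n} m d → HasOrder q n r → r ≡ m * d → q ∣ ∣ (n ℤ.^ m) ℤ.^ d - 1ℤ ∣
  power-order {q} {n = n} m d (_ , q∣n^r-1 , _) r≡md =
    subst (λ t → q ∣ ∣ t - 1ℤ ∣) (trans (cong (n ℤ.^_) r≡md) (sym (^-*-assoc n m d))) q∣n^r-1

  power-below-order : ∀ {q r n} m e d → HasOrder q n r → r ≡ m * e * d → 0 < m * e → 2 ≤ d →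
    ¬ q ∣ ∣ (n ℤ.^ m) ℤ.^ e - 1ℤ ∣
  power-below-order {q} {n = n} m e d (_ , _ , minimal) r≡med 0<me 2≤d q∣ =
    minimal (m * e) 0<me (subst (m * e <_) (sym r≡med) (ℕ.m<m*n (m * e) d {{ℕ.>-nonZero 0<me}} 2≤d))
      (subst (λ t → q ∣ ∣ t - 1ℤ ∣) (^-*-assoc n m e) q∣)

  weaken-bound : ∀ {q c F} n m e → 1 ≤ ∣ n ∣ → c ≤ m * e → m * e ≤ F →
    q ≤ c * ∣ n ℤ.^ m ∣ ^ e → q ≤ F * ∣ n ∣ ^ F
  weaken-bound {q} {c} {F} n m e 1≤∣n∣ c≤me me≤F q≤ = ℕ.≤-trans q≤ (begin
    c * ∣ n ℤ.^ m ∣ ^ e      ≡⟨ cong (λ t → c * t ^ e) (∣^∣ n m) ⟩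
    c * (∣ n ∣ ^ m) ^ e      ≡⟨ cong (c *_) (ℕ.^-*-assoc ∣ n ∣ m e) ⟩
    c * ∣ n ∣ ^ (m * e)      ≤⟨ ℕ.*-mono-≤ (ℕ.≤-trans c≤me me≤F) (ℕ.^-monoʳ-≤ ∣ n ∣ {{ℕ.>-nonZero 1≤∣n∣}} me≤F) ⟩
    F * ∣ n ∣ ^ F            ∎)
    where open ℕ.≤-Reasoning

  2≤∣pow∣ : ∀ {n} m → 2 ≤ ∣ n ∣ → 0 < m → 2 ≤ ∣ n ℤ.^ m ∣
  2≤∣pow∣ {n} (suc m') 2≤∣n∣ _ = subst (2 ≤_) (sym (∣^∣ n (suc m'))) (2≤^suc m' 2≤∣n∣)

  -- Case r = m p with p ≥ 3 the only prime factor of r: N = n ^ m has order p, so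
  -- q ≤ 2 |N| ^ (p - 1), and 2 ≤ m (p - 1) ≤ φ r.
  one-prime-case : ∀ {q r n p} → Prime q → HasOrder q n r → 2 ≤ ∣ n ∣ → r ≢ 0 →
    Prime p → 3 ≤ p → p ∣ r → (∀ ℓ → Prime ℓ → ℓ ∣ r → ℓ ≡ p) → q ≤ φ r * ∣ n ∣ ^ φ r
  one-prime-case {q} {r} {n} {suc p'} pq order@(_ , _ , minimal) 2≤∣n∣ r≢0 pp (s≤s 2≤p') (divides m r≡mp) only =
    weaken-bound n m p' (ℕ.<⇒≤ 2≤∣n∣) 2≤mp' (φ-one-prime m p' r≢0 r≡mp only)
      (one-prime-bound p' (n ℤ.^ m) pq (2≤∣pow∣ m 2≤∣n∣ 0<m) (power-order m (suc p') order r≡mp) n^m≢1)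
    where
    0<m : 0 < m
    0<m = ℕ.n≢0⇒n>0 λ m≡0 → r≢0 (trans r≡mp (cong (_* suc p') m≡0))
    n^m≢1 : ¬ q ∣ ∣ n ℤ.^ m - 1ℤ ∣
    n^m≢1 = minimal m 0<m (subst (m <_) (sym r≡mp) (ℕ.m<m*n m (suc p') {{ℕ.>-nonZero 0<m}} (ℕ.m≤n⇒m≤1+n 2≤p')))
    2≤mp' : 2 ≤ m * p'
    2≤mp' = ℕ.≤-trans 2≤p' (ℕ.m≤n*m p' m {{ℕ.>-nonZero 0<m}})

  -- Case r = m p s with p ≠ s (both ≥ 3) the only prime factors of r: N = n ^ m has order p s, so
  -- q ≤ 4 |N| ^ ((p - 1)(s - 1)), and 4 ≤ m (p - 1)(s - 1) ≤ φ r.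
  two-prime-case : ∀ {q r n p s} → Prime q → HasOrder q n r → 2 ≤ ∣ n ∣ → r ≢ 0 →
    Prime p → Prime s → p ≢ s → 3 ≤ p → 3 ≤ s → p ∣ r → s ∣ r →
    (∀ ℓ → Prime ℓ → ℓ ∣ r → ℓ ≡ p ⊎ ℓ ≡ s) → q ≤ φ r * ∣ n ∣ ^ φ r
  two-prime-case {q} {r} {n} {suc p'} {suc s'} pq order 2≤∣n∣ r≢0 pp ps p≢s (s≤s 2≤p') (s≤s 2≤s') p∣r s∣r only
    with coprime-product∣ (distinct-primes-coprime pp ps p≢s) p∣r s∣r
  ... | divides m r≡mps =
    weaken-bound n m (p' * s') (ℕ.<⇒≤ 2≤∣n∣) 4≤mp's' (φ-two-primes m p' s' r≢0 pp ps p≢s r≡mps only)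
      (two-prime-bound p' s' (n ℤ.^ m) pq pp ps p≢s (2≤∣pow∣ m 2≤∣n∣ 0<m) N^sp≡1
        (power-below-order m (suc s') (suc p') order r≡msp (0<m*suc s') (ℕ.m≤n⇒m≤1+n 2≤p'))
        (power-below-order m (suc p') (suc s') order (trans r≡mps (sym (ℕ.*-assoc m _ _)))
                           (0<m*suc p') (ℕ.m≤n⇒m≤1+n 2≤s')))
    where
    0<m : 0 < m
    0<m = ℕ.n≢0⇒n>0 λ m≡0 → r≢0 (trans r≡mps (cong (_* _) m≡0))
    0<m*suc : ∀ k → 0 < m * suc k
    0<m*suc k = ℕ.≤-trans 0<m (ℕ.m≤m*n m (suc k))
    r≡msp : r ≡ m * suc s' * suc p'
    r≡msp = trans r≡mps (trans (cong (m *_) (ℕ.*-comm (suc p') (suc s'))) (sym (ℕ.*-assoc m _ _)))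
    N^sp≡1 : q ∣ ∣ ((n ℤ.^ m) ℤ.^ suc s') ℤ.^ suc p' - 1ℤ ∣
    N^sp≡1 = subst (λ t → q ∣ ∣ t ℤ.^ suc p' - 1ℤ ∣) (sym (^-*-assoc n m (suc s')))
               (power-order (m * suc s') (suc p') order r≡msp)
    4≤mp's' : 4 ≤ m * (p' * s')
    4≤mp's' = ℕ.≤-trans (ℕ.*-mono-≤ 2≤p' 2≤s') (ℕ.m≤n*m (p' * s') m {{ℕ.>-nonZero 0<m}})

open import Defs
open import Data.Nat using (ℕ; _<_; _≤_; _*_; _^_)
open import Data.Nat.Primality using (Prime)
open import Data.Integer using (ℤ; ∣_∣)
open import Data.Product using (∃; _,_)
import Data.Nat.Properties as ℕ
open Primes using (prime-factor; odd-prime≥3)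
open PrimeFactorShapes using (prime-support; only-p; p-and)
open OrderCases using (order>2⇒2≤∣n∣; one-prime-case; two-prime-case)

-- Pick a prime factor p of r; by the hypothesis on r it is either the only one or has exactly one
-- companion s, and every prime factor is ≥ 3 since all of them are odd.
mainTheorem1 : (q r : ℕ) → Prime q → 2 < r →
    ∃ (λ x → HasOrder q x r) →
    AtMostTwoPrimeFactors r → OddPrimeFactors r →
    (n : ℤ) → IsMinimalResidue q n → HasOrder q n r →
    ((m : ℤ) → IsMinimalResidue q m → HasOrder q m r → ∣ n ∣ ≤ ∣ m ∣) →
    q ≤ φ r * (∣ n ∣ ^ φ r)
mainTheorem1 q r pq 2<r _ at-most-two odd n _ order _ with prime-factor r (ℕ.<⇒≤ 2<r)
... | p , pp , p∣r with prime-support at-most-two pp p∣r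
...   | only-p only =
  one-prime-case pq order (order>2⇒2≤∣n∣ pq 2<r order) (ℕ.m<n⇒n≢0 2<r)
    pp (odd-prime≥3 pp (odd p pp p∣r)) p∣r only
...   | p-and s ps s∣r p≢s only =
  two-prime-case pq order (order>2⇒2≤∣n∣ pq 2<r order) (ℕ.m<n⇒n≢0 2<r)
    pp ps p≢s (odd-prime≥3 pp (odd p pp p∣r)) (odd-prime≥3 ps (odd s ps s∣r)) p∣r s∣r only
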